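{- The formula with reversal $\phi_2 = xy_1y_2x\cdot y_1^R\cdot y_2^R$ is $5$-avoidable.
   Context: Let $\Sigma$ be a set of variables and $\Sigma^R=\{x^R:x\in\Sigma\}$. For words, $(a_1\cdots a_n)^R=a_n\cdots a_1$. A morphism $h$ on $(\Sigma\cup\Sigma^R)^*$ respects reversal if $h(x^R)=h(x)^R$. The formula $\phi_2$ consists of the fragments $xy_1y_2x$, $y_1^R$, $y_2^R$; it occurs in a word $u$ if there is a non-erasing morphism $h$ respecting reversal such that the images of all three fragments are factors of $u$; otherwise $u$ avoids it. A formula is $k$-avoidable if infinitely many words over a $k$-letter alphabet avoid it. -}

module Defs where

open import Data.Nat using (ℕ; _≤_)
open import Data.Fin using (Fin; zero; suc)
open import Data.List using (List; []; _∷_; _++_; reverse; concatMap; length)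
open import Data.List.Relation.Unary.All using (All)
open import Data.Product using (Σ; ∃; _×_)
open import Relation.Binary.PropositionalEquality using (_≡_; _≢_)
open import Relation.Nullary using (¬_)

data Lit (V : Set) : Set where
  var : V → Lit V
  rev : V → Lit V

-- A morphism respecting reversal is determined by the images of the
-- variables; on reversed letters it is forced: h(x^R) = h(x)^R.
imageLit : {V A : Set} → (V → List A) → Lit V → List A
imageLit h (var x) = h x
imageLit h (rev x) = reverse (h x)

image : {V A : Set} → (V → List A) → List (Lit V) → List A
image h f = concatMap (imageLit h) f

NonErasing : {V A : Set} → (V → List A) → Set
NonErasing h = ∀ x → h x ≢ []

Factor : {A : Set} → List A → List A → Set
Factor {A} u w = Σ (List A) λ p → Σ (List A) λ s → p ++ u ++ s ≡ w

-- A formula with reversal: a list of fragments.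
Formula : Set → Set
Formula V = List (List (Lit V))

Occurs : {V A : Set} → Formula V → List A → Set
Occurs {V} {A} F w =
  Σ (V → List A) λ h → NonErasing h × All (λ f → Factor (image h f) w) F

Avoids : {V A : Set} → List A → Formula V → Set
Avoids w F = ¬ Occurs F w

-- Infinitely many words over a k-letter alphabet avoid F
-- (over a finite alphabet: avoiding words of unbounded length).
Avoidable : {V : Set} → ℕ → Formula V → Set
Avoidable k F = ∀ n → Σ (List (Fin k)) λ w → n ≤ length w × Avoids w F

x y₁ y₂ : Fin 3
x = zero
y₁ = suc zero
y₂ = suc (suc zero)

φ₂ : Formula (Fin 3)
φ₂ = (var x ∷ var y₁ ∷ var y₂ ∷ var x ∷ [])
   ∷ (rev y₁ ∷ [])
   ∷ (rev y₂ ∷ [])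
   ∷ []

-- The avoiding word is built from the square-free word vtm(i) = 2 + t(i+1) − t(i) over
-- {1, 2, 3}, where t is the Thue–Morse word: the colours 0, 1, 2, 3, 4, 0, 1, … are written in
-- blocks, the block ρ having length vtm ⌊ρ/5⌋. Colours only advance cyclically along the word, so a
-- factor whose reversal also occurs lies inside one block; hence y₁ and y₂ each lie in one block and
-- the second copy of x starts at most three blocks after the first one ends. Equal colours keep the
-- two copies of x aligned block by block, shifted by 5k blocks, and k ≥ 1 because the copies are at
-- least three positions apart. The block lengths under the first copy therefore repeat after 5k
-- blocks, giving a square of period k in vtm; but a square in vtm lifts either to an overlap or to
-- a triple aaa in the overlap-free Thue–Morse word.
module Submission where

open import Defs
open import Data.Nat
  using (ℕ; zero; suc; _+_; _*_; _∸_; _≤_; _<_; _≤′_; ≤′-reflexive; ≤′-step; _≤?_; z≤n; s≤s; ⌊_/2⌋; ⌈_/2⌉; parity; NonZero)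
open import Data.Nat.DivMod
  using (_%_; _/_; _mod_; m%n<n; m≡m%n+[m/n]*n; %-distribˡ-+; +-distrib-/-∣ˡ; m*n/n≡m; %-remove-+ˡ)
open import Data.Nat.Divisibility using (_∣_; divides; n∣m*n; >⇒∤)
open import Data.Nat.Properties
open import Data.Nat.Induction using (<-wellFounded)
open import Data.Nat.Tactic.RingSolver using (solve-∀)
open import Data.Parity.Base as ℙ using (Parity; 0ℙ; 1ℙ; _⁻¹)
open import Data.Parity.Properties as ℙₚ using (p≢p⁻¹; ⁻¹-involutive; +-homo-+; p+p≡0ℙ)
open import Data.Fin using (Fin; toℕ)
open import Data.Fin.Properties using (toℕ-fromℕ<)
open import Data.List using (List; []; _∷_; _++_; reverse; _ʳ++_; length; applyUpTo)
open import Data.List.Properties using (length-applyUpTo; ʳ++-defn)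
open import Data.List.Relation.Unary.All using ([]; _∷_)
open import Data.Unit using (⊤; tt)
open import Data.Sum using (_⊎_; inj₁; inj₂)
open import Data.Product using (∃-syntax; _×_; _,_; proj₁; proj₂)
open import Data.Empty using (⊥; ⊥-elim)
open import Induction.WellFounded using (Acc; acc)
open import Algebra.Properties.CommutativeSemigroup +-commutativeSemigroup using (xy∙z≈xz∙y; x∙yz≈y∙xz)
open import Relation.Nullary using (¬_; yes; no)
open import Relation.Binary.PropositionalEquality

-- The parity of the binary digit sum of n, computed with fuel f; any f > n suffices.
thueMorseFuel : ℕ → ℕ → Parity
thueMorseFuel zero    n = 0ℙ
thueMorseFuel (suc f) n = parity n ℙ.+ thueMorseFuel f ⌊ n /2⌋

thueMorse : ℕ → Parity
thueMorse n = thueMorseFuel (suc n) n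

thueMorseFuel-zero : ∀ f → thueMorseFuel f 0 ≡ 0ℙ
thueMorseFuel-zero zero    = refl
thueMorseFuel-zero (suc f) = thueMorseFuel-zero f

thueMorseFuel-stable : ∀ {f g} n → n < f → n < g → thueMorseFuel f n ≡ thueMorseFuel g n
thueMorseFuel-stable {suc f} {suc g} zero    _         _         =
  trans (thueMorseFuel-zero f) (sym (thueMorseFuel-zero g))
thueMorseFuel-stable {suc f} {suc g} (suc n) (s≤s n<f) (s≤s n<g) =
  cong (parity (suc n) ℙ.+_)
       (thueMorseFuel-stable ⌊ suc n /2⌋ (<-≤-trans (⌊n/2⌋<n n) n<f) (<-≤-trans (⌊n/2⌋<n n) n<g))

parity-double : ∀ n → parity (n + n) ≡ 0ℙ
parity-double n = trans (+-homo-+ n n) (p+p≡0ℙ (parity n))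

thueMorse-double : ∀ n → thueMorse (n + n) ≡ thueMorse n
thueMorse-double zero        = refl
thueMorse-double n@(suc _) = begin
  parity (n + n) ℙ.+ thueMorseFuel (n + n) ⌊ n + n /2⌋
    ≡⟨ cong₂ ℙ._+_ (parity-double n) (cong (thueMorseFuel (n + n)) (sym (n≡⌊n+n/2⌋ n))) ⟩
  thueMorseFuel (n + n) n
    ≡⟨ thueMorseFuel-stable n (m<m+n n (s≤s z≤n)) (n<1+n n) ⟩
  thueMorse n ∎
  where open ≡-Reasoning

thueMorse-suc-double : ∀ n → thueMorse (suc (n + n)) ≡ thueMorse n ⁻¹
thueMorse-suc-double n = begin
  parity (1 + (n + n)) ℙ.+ thueMorseFuel (suc (n + n)) ⌈ n + n /2⌉
    ≡⟨ cong₂ ℙ._+_ (trans (+-homo-+ 1 (n + n)) (cong (1ℙ ℙ.+_) (parity-double n)))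
                   (cong (thueMorseFuel (suc (n + n))) (sym (n≡⌈n+n/2⌉ n))) ⟩
  thueMorseFuel (suc (n + n)) n ⁻¹
    ≡⟨ cong _⁻¹ (thueMorseFuel-stable n (s≤s (m≤m+n n n)) (n<1+n n)) ⟩
  thueMorse n ⁻¹ ∎
  where open ≡-Reasoning

data Half : ℕ → Set where
  even : ∀ a → Half (a + a)
  odd  : ∀ a → Half (suc (a + a))

half : ∀ n → Half n
half zero    = even 0
half (suc n) with half n
... | even a = odd a
... | odd a  = subst Half (cong suc (+-suc a a)) (even (suc a))

thueMorse-pair : ∀ a → thueMorse (a + a) ≢ thueMorse (suc (a + a))
thueMorse-pair a eq =
  p≢p⁻¹ (thueMorse a) (trans (sym (thueMorse-double a)) (trans eq (thueMorse-suc-double a)))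

thueMorse-noTriple : ∀ c → thueMorse c ≡ thueMorse (suc c) → thueMorse (suc c) ≢ thueMorse (suc (suc c))
thueMorse-noTriple c eq₁ eq₂ with half c
... | even a = thueMorse-pair a eq₁
... | odd a  = thueMorse-pair (suc a)
                 (subst (λ n → thueMorse n ≡ thueMorse (suc n)) (cong suc (sym (+-suc a a))) eq₂)

thueMorse-cross : ∀ a c → thueMorse (a + a) ≡ thueMorse (suc (c + c)) →
                  thueMorse (suc (a + a)) ≡ thueMorse (suc (suc (c + c))) →
                  thueMorse c ≡ thueMorse (suc c)
thueMorse-cross a c eq₁ eq₂ = begin
  thueMorse c                     ≡⟨ ⁻¹-involutive (thueMorse c) ⟨
  thueMorse c ⁻¹ ⁻¹               ≡⟨ cong _⁻¹ (thueMorse-suc-double c) ⟨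
  thueMorse (suc (c + c)) ⁻¹      ≡⟨ cong _⁻¹ eq₁ ⟨
  thueMorse (a + a) ⁻¹            ≡⟨ cong _⁻¹ (thueMorse-double a) ⟩
  thueMorse a ⁻¹                  ≡⟨ thueMorse-suc-double a ⟨
  thueMorse (suc (a + a))         ≡⟨ eq₂ ⟩
  thueMorse (suc (suc (c + c)))   ≡⟨ cong (λ n → thueMorse (suc n)) (+-suc c c) ⟨
  thueMorse (suc c + suc c)       ≡⟨ thueMorse-double (suc c) ⟩
  thueMorse (suc c)               ∎
  where open ≡-Reasoning

Overlap : {A : Set} → (ℕ → A) → ℕ → ℕ → Set
Overlap f i p = ∀ j → j ≤ p → f (j + i) ≡ f (j + (p + i))

overlap-at : ∀ {A : Set} (f : ℕ → A) {i p j x y} → Overlap f i p → j ≤ p →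
             j + i ≡ x → j + (p + i) ≡ y → f x ≡ f y
overlap-at f ov j≤p refl refl = ov _ j≤p

thueMorse-halveOverlap : ∀ i q → Overlap thueMorse i (q + q) → ∃[ a ] Overlap thueMorse a q
thueMorse-halveOverlap i q ov with half i
... | even a = a , λ l l≤q → begin
  thueMorse (l + a)              ≡⟨ thueMorse-double (l + a) ⟨
  thueMorse ((l + a) + (l + a))  ≡⟨ overlap-at thueMorse ov (+-mono-≤ l≤q l≤q) (outer l a) (inner l q a) ⟩
  thueMorse ((l + (q + a)) + (l + (q + a))) ≡⟨ thueMorse-double (l + (q + a)) ⟩
  thueMorse (l + (q + a))        ∎
  where
  open ≡-Reasoning
  outer : ∀ l a → (l + l) + (a + a) ≡ (l + a) + (l + a)
  outer = solve-∀
  inner : ∀ l q a → (l + l) + ((q + q) + (a + a)) ≡ (l + (q + a)) + (l + (q + a))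
  inner = solve-∀
... | odd a = a , λ l l≤q → ℙₚ.⁻¹-injective (begin
  thueMorse (l + a) ⁻¹                    ≡⟨ thueMorse-suc-double (l + a) ⟨
  thueMorse (suc ((l + a) + (l + a)))     ≡⟨ overlap-at thueMorse ov (+-mono-≤ l≤q l≤q) (outer l a) (inner l q a) ⟩
  thueMorse (suc ((l + (q + a)) + (l + (q + a)))) ≡⟨ thueMorse-suc-double (l + (q + a)) ⟩
  thueMorse (l + (q + a)) ⁻¹              ∎)
  where
  open ≡-Reasoning
  outer : ∀ l a → (l + l) + suc (a + a) ≡ suc ((l + a) + (l + a))
  outer = solve-∀
  inner : ∀ l q a → (l + l) + ((q + q) + suc (a + a)) ≡ suc ((l + (q + a)) + (l + (q + a)))
  inner = solve-∀

thueMorse-oddOverlap : ∀ i b → Overlap thueMorse i (suc (b + b)) →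
                       ∃[ c ] ∀ m → m ≤ b → thueMorse (m + c) ≡ thueMorse (suc (m + c))
thueMorse-oddOverlap i b ov with half i
... | even a = b + a , λ m m≤b →
  thueMorse-cross (m + a) (m + (b + a))
    (overlap-at thueMorse ov (m≤n⇒m≤1+n (+-mono-≤ m≤b m≤b)) (outer m a) (inner m b a))
    (overlap-at thueMorse ov (s≤s (+-mono-≤ m≤b m≤b)) (cong suc (outer m a)) (cong suc (inner m b a)))
  where
  outer : ∀ m a → (m + m) + (a + a) ≡ (m + a) + (m + a)
  outer = solve-∀
  inner : ∀ m b a → (m + m) + (suc (b + b) + (a + a)) ≡ suc ((m + (b + a)) + (m + (b + a)))
  inner = solve-∀
... | odd a = a , λ m m≤b →
  thueMorse-cross (suc (m + (b + a))) (m + a)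
    (sym (overlap-at thueMorse ov (m≤n⇒m≤1+n (+-mono-≤ m≤b m≤b)) (outer m a) (inner m b a)))
    (sym (overlap-at thueMorse ov (s≤s (+-mono-≤ m≤b m≤b)) (cong suc (outer m a)) (cong suc (inner m b a))))
  where
  outer : ∀ m a → (m + m) + suc (a + a) ≡ suc ((m + a) + (m + a))
  outer = solve-∀
  inner : ∀ m b a → (m + m) + (suc (b + b) + suc (a + a)) ≡ suc (m + (b + a)) + suc (m + (b + a))
  inner = solve-∀

thueMorse-overlapFree-acc : ∀ {p} → Acc _<_ p → 0 < p → ∀ i → ¬ Overlap thueMorse i p
thueMorse-overlapFree-acc {p} (acc rec) 0<p i ov with half p
thueMorse-overlapFree-acc (acc rec) () i ov | even zero
... | even (suc q) = let a , ov′ = thueMorse-halveOverlap i (suc q) ov in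
  thueMorse-overlapFree-acc (rec (m<m+n (suc q) (s≤s z≤n))) (s≤s z≤n) a ov′
... | odd zero = thueMorse-noTriple i (ov 0 z≤n) (ov 1 (s≤s z≤n))
... | odd (suc b) = let c , run = thueMorse-oddOverlap i (suc b) ov in
  thueMorse-noTriple c (run 0 z≤n) (run 1 (s≤s z≤n))

thueMorse-overlapFree : ∀ p i → ¬ Overlap thueMorse i (suc p)
thueMorse-overlapFree p = thueMorse-overlapFree-acc (<-wellFounded (suc p)) (s≤s z≤n)

-- δ a b = 2 + b − a, so vtm is the difference sequence of t moved into {1, 2, 3}.
δ : Parity → Parity → ℕ
δ 0ℙ 0ℙ = 2
δ 1ℙ 1ℙ = 2
δ 0ℙ 1ℙ = 3
δ 1ℙ 0ℙ = 1

δ-pos : ∀ a b → 0 < δ a b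
δ-pos 0ℙ 0ℙ = s≤s z≤n
δ-pos 1ℙ 1ℙ = s≤s z≤n
δ-pos 0ℙ 1ℙ = s≤s z≤n
δ-pos 1ℙ 0ℙ = s≤s z≤n

δ≤3 : ∀ a b → δ a b ≤ 3
δ≤3 0ℙ 0ℙ = s≤s (s≤s z≤n)
δ≤3 1ℙ 1ℙ = s≤s (s≤s z≤n)
δ≤3 0ℙ 1ℙ = s≤s (s≤s (s≤s z≤n))
δ≤3 1ℙ 0ℙ = s≤s z≤n

δ-cancelˡ : ∀ a {b d} → δ a b ≡ δ a d → b ≡ d
δ-cancelˡ 0ℙ {0ℙ} {0ℙ} _  = refl
δ-cancelˡ 0ℙ {1ℙ} {1ℙ} _  = refl
δ-cancelˡ 1ℙ {0ℙ} {0ℙ} _  = refl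
δ-cancelˡ 1ℙ {1ℙ} {1ℙ} _  = refl
δ-cancelˡ 0ℙ {0ℙ} {1ℙ} ()
δ-cancelˡ 0ℙ {1ℙ} {0ℙ} ()
δ-cancelˡ 1ℙ {0ℙ} {1ℙ} ()
δ-cancelˡ 1ℙ {1ℙ} {0ℙ} ()

δ-≢ : ∀ {a b c d} → δ a b ≡ δ c d → a ≢ c → a ≡ b × c ≡ d
δ-≢ {0ℙ} {_}  {0ℙ} {_}  _  a≢c = ⊥-elim (a≢c refl)
δ-≢ {1ℙ} {_}  {1ℙ} {_}  _  a≢c = ⊥-elim (a≢c refl)
δ-≢ {0ℙ} {0ℙ} {1ℙ} {1ℙ} _  _   = refl , refl
δ-≢ {1ℙ} {1ℙ} {0ℙ} {0ℙ} _  _   = refl , refl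
δ-≢ {0ℙ} {0ℙ} {1ℙ} {0ℙ} ()
δ-≢ {0ℙ} {1ℙ} {1ℙ} {0ℙ} ()
δ-≢ {0ℙ} {1ℙ} {1ℙ} {1ℙ} ()
δ-≢ {1ℙ} {0ℙ} {0ℙ} {0ℙ} ()
δ-≢ {1ℙ} {0ℙ} {0ℙ} {1ℙ} ()
δ-≢ {1ℙ} {1ℙ} {0ℙ} {1ℙ} ()

vtm : ℕ → ℕ
vtm i = δ (thueMorse i) (thueMorse (suc i))

Square : {A : Set} → (ℕ → A) → ℕ → ℕ → Set
Square f i p = ∀ j → j < p → f (j + i) ≡ f (j + (p + i))

vtm-square-misaligned : ∀ k i → Square vtm i (suc k) → thueMorse i ≢ thueMorse (suc k + i) →
                        thueMorse i ≡ thueMorse (suc i) × thueMorse (suc i) ≡ thueMorse (suc (suc i))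
vtm-square-misaligned zero    i sq ne = δ-≢ (sq 0 (s≤s z≤n)) ne
vtm-square-misaligned (suc k) i sq ne =
  proj₁ ends , proj₁ (δ-≢ (sq 1 (s≤s (s≤s z≤n)))
                          (λ eq → ne (trans (proj₁ ends) (trans eq (sym (proj₂ ends))))))
  where ends = δ-≢ (sq 0 (s≤s z≤n)) ne

vtm-squareFree : ∀ k i → ¬ Square vtm i (suc k)
vtm-squareFree k i sq with thueMorse i ℙₚ.≟ thueMorse (suc k + i)
... | yes eq = thueMorse-overlapFree k i lifted
  where
  lifted : Overlap thueMorse i (suc k)
  lifted zero    _         = eq
  lifted (suc j) (s≤s j≤k) = δ-cancelˡ (thueMorse (j + i)) (trans (sq j (s≤s j≤k))
    (cong (λ a → δ a (thueMorse (suc (j + (suc k + i))))) (sym (lifted j (m≤n⇒m≤1+n j≤k)))))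
... | no ne = let eq₁ , eq₂ = vtm-square-misaligned k i sq ne in thueMorse-noTriple i eq₁ eq₂

%-≡⇒∣ : ∀ n .{{_ : NonZero n}} d m → (d + m) % n ≡ m % n → n ∣ d
%-≡⇒∣ n d m eq = divides ((d + m) / n ∸ m / n) (begin
  d                                                     ≡⟨ m+n∸n≡m d m ⟨
  (d + m) ∸ m
    ≡⟨ cong₂ _∸_ (m≡m%n+[m/n]*n (d + m) n) (m≡m%n+[m/n]*n m n) ⟩
  ((d + m) % n + (d + m) / n * n) ∸ (m % n + m / n * n)
    ≡⟨ cong (λ x → (x + (d + m) / n * n) ∸ (m % n + m / n * n)) eq ⟩
  (m % n + (d + m) / n * n) ∸ (m % n + m / n * n)       ≡⟨ [m+n]∸[m+o]≡n∸o (m % n) _ _ ⟩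
  (d + m) / n * n ∸ m / n * n                           ≡⟨ *-distribʳ-∸ n ((d + m) / n) (m / n) ⟨
  ((d + m) / n ∸ m / n) * n                             ∎)
  where open ≡-Reasoning

%-+-≢ : ∀ n .{{_ : NonZero n}} d m → suc d < n → (suc d + m) % n ≢ m % n
%-+-≢ n d m 1+d<n eq = >⇒∤ 1+d<n (%-≡⇒∣ n (suc d) m eq)

%-cong-suc : ∀ n .{{_ : NonZero n}} m o → m % n ≡ o % n → suc m % n ≡ suc o % n
%-cong-suc n m o eq = begin
  (1 + m) % n             ≡⟨ %-distribˡ-+ 1 m n ⟩
  (1 % n + m % n) % n     ≡⟨ cong (λ x → (1 % n + x) % n) eq ⟩
  (1 % n + o % n) % n     ≡⟨ %-distribˡ-+ 1 o n ⟨
  (1 + o) % n             ∎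
  where open ≡-Reasoning

[m*n+o]/n≡m+o/n : ∀ m o n .{{_ : NonZero n}} → (m * n + o) / n ≡ m + o / n
[m*n+o]/n≡m+o/n m o n = trans (+-distrib-/-∣ˡ o (n∣m*n m)) (cong (_+ o / n) (m*n/n≡m m n))

-- The positive lengths len ρ cut ℕ into consecutive blocks [start ρ, start (ρ + 1));
-- block y is the index of the block containing y.
module Blocks (len : ℕ → ℕ) (len-pos : ∀ ρ → 0 < len ρ) where

  start : ℕ → ℕ
  start zero    = 0
  start (suc ρ) = start ρ + len ρ

  start-<-suc : ∀ ρ → start ρ < start (suc ρ)
  start-<-suc ρ = m<m+n (start ρ) (len-pos ρ)

  start-mono-≤′ : ∀ {ρ σ} → ρ ≤′ σ → start ρ ≤ start σ
  start-mono-≤′ (≤′-reflexive refl) = ≤-refl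
  start-mono-≤′ (≤′-step ρ≤σ)       = ≤-trans (start-mono-≤′ ρ≤σ) (m≤m+n _ _)

  start-mono-≤ : ∀ {ρ σ} → ρ ≤ σ → start ρ ≤ start σ
  start-mono-≤ ρ≤σ = start-mono-≤′ (≤⇒≤′ ρ≤σ)

  block : ℕ → ℕ
  block zero = 0
  block (suc y) with start (suc (block y)) ≤? suc y
  ... | yes _ = suc (block y)
  ... | no  _ = block y

  block-step : ∀ y → block (suc y) ≡ block y ⊎ block (suc y) ≡ suc (block y)
  block-step y with start (suc (block y)) ≤? suc y
  ... | yes _ = inj₂ refl
  ... | no  _ = inj₁ refl

  block-within : ∀ y → start (block y) ≤ y × y < start (suc (block y))
  block-within zero = z≤n , start-<-suc 0
  block-within (suc y) with start (suc (block y)) ≤? suc y | block-within y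
  ... | yes start≤ | _ , y<start = start≤ , ≤-<-trans y<start (start-<-suc (suc (block y)))
  ... | no  start≰ | start≤ , _ = m≤n⇒m≤1+n start≤ , ≰⇒> start≰

  ≤block⇒start≤ : ∀ {ρ y} → ρ ≤ block y → start ρ ≤ y
  ≤block⇒start≤ {y = y} ρ≤block = ≤-trans (start-mono-≤ ρ≤block) (proj₁ (block-within y))

  start≤⇒≤block : ∀ {ρ y} → start ρ ≤ y → ρ ≤ block y
  start≤⇒≤block {y = y} start≤y =
    ≮⇒≥ (λ block<ρ → <⇒≱ (proj₂ (block-within y)) (≤-trans (start-mono-≤ block<ρ) start≤y))

  <start⇒block< : ∀ {ρ y} → y < start ρ → block y < ρ
  <start⇒block< y<start = ≰⇒> (λ ρ≤block → <⇒≱ y<start (≤block⇒start≤ ρ≤block))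

  block<⇒<start : ∀ {ρ y} → block y < ρ → y < start ρ
  block<⇒<start block<ρ = ≰⇒> (λ start≤y → <⇒≱ block<ρ (start≤⇒≤block start≤y))

  block-mono-≤ : ∀ {y z} → y ≤ z → block y ≤ block z
  block-mono-≤ {y} y≤z = start≤⇒≤block (≤-trans (proj₁ (block-within y)) y≤z)

  block-suc-≤ : ∀ y → block (suc y) ≤ suc (block y)
  block-suc-≤ y with block-step y
  ... | inj₁ eq = ≤-trans (≤-reflexive eq) (n≤1+n (block y))
  ... | inj₂ eq = ≤-reflexive eq

  block-start : ∀ ρ → block (start ρ) ≡ ρ
  block-start ρ = ≤-antisym (≮⇒≥ (λ ρ<block → <⇒≱ (start-<-suc ρ) (≤block⇒start≤ ρ<block)))
                            (start≤⇒≤block ≤-refl)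

  block-<-jump : ∀ {B} → (∀ ρ → len ρ ≤ B) → ∀ y → block y < block (B + y)
  block-<-jump {B} len≤B y = start≤⇒≤block
    (≤-trans (+-mono-≤ (proj₁ (block-within y)) (len≤B (block y))) (≤-reflexive (+-comm y B)))

  start-≡ : ∀ {σ y} → σ ≤ block (suc y) → block y < σ → start σ ≡ suc y
  start-≡ σ≤block block<σ = ≤-antisym (≤block⇒start≤ σ≤block) (block<⇒<start block<σ)

  module _ {r s D L : ℕ} (shifted : ∀ l → l ≤ L → block (l + s) ≡ D + block (l + r)) where

    start-shift : ∀ {ρ} → block r < ρ → ρ ≤ block (L + r) → start (D + ρ) + r ≡ start ρ + s
    start-shift {ρ} r-before ρ≤ = begin
      start (D + ρ) + r ≡⟨ cong (_+ r) start-Dρ ⟩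
      suc l + s + r     ≡⟨ xy∙z≈xz∙y (suc l) s r ⟩
      suc l + r + s     ≡⟨ cong (_+ s) start-ρ ⟩
      start ρ + s       ∎
      where
      open ≡-Reasoning
      l = start ρ ∸ suc r
      start-ρ : suc l + r ≡ start ρ
      start-ρ = trans (sym (+-suc l r)) (m∸n+n≡m (block<⇒<start r-before))
      l<L : suc l ≤ L
      l<L = +-cancelʳ-≤ r (suc l) L (subst (_≤ L + r) (sym start-ρ) (≤block⇒start≤ ρ≤))
      start-Dρ : start (D + ρ) ≡ suc l + s
      start-Dρ = start-≡
        (≤-reflexive (sym (trans (shifted (suc l) l<L) (cong (D +_) (trans (cong block start-ρ) (block-start ρ))))))
        (subst (_< D + ρ) (sym (shifted l (<⇒≤ l<L))) (+-monoʳ-< D (<start⇒block< (≤-reflexive start-ρ))))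

    len-shift : ∀ {ρ} → block r < ρ → suc ρ ≤ block (L + r) → len (D + ρ) ≡ len ρ
    len-shift {ρ} r-before ρ< = +-cancelˡ-≡ (start ρ + s) _ _ (begin
      start ρ + s + len (D + ρ)       ≡⟨ cong (_+ len (D + ρ)) (start-shift r-before (<⇒≤ ρ<)) ⟨
      start (D + ρ) + r + len (D + ρ) ≡⟨ xy∙z≈xz∙y (start (D + ρ)) r (len (D + ρ)) ⟩
      start (suc (D + ρ)) + r         ≡⟨ cong (λ σ → start σ + r) (+-suc D ρ) ⟨
      start (D + suc ρ) + r           ≡⟨ start-shift (<-trans r-before (n<1+n ρ)) ρ< ⟩
      start (suc ρ) + s               ≡⟨ xy∙z≈xz∙y (start ρ) (len ρ) s ⟩
      start ρ + s + len ρ             ∎)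
      where open ≡-Reasoning

StepsBy01 : (ℕ → ℕ) → Set
StepsBy01 f = ∀ l → f (suc l) ≡ f l ⊎ f (suc l) ≡ suc (f l)

-- Agreement mod n rules out one sequence stepping while the other stays, so the offset D persists.
lockstep : ∀ n .{{_ : NonZero n}} → 1 < n → ∀ {f g : ℕ → ℕ} {D L} → StepsBy01 f → StepsBy01 g → n ∣ D →
           (∀ l → l ≤ L → f l % n ≡ g l % n) → g 0 ≡ D + f 0 → ∀ l → l ≤ L → g l ≡ D + f l
lockstep n 1<n f-steps g-steps n∣D agree g₀ zero    _   = g₀
lockstep n 1<n {f} {g} {D} f-steps g-steps n∣D agree g₀ (suc l) l<L = step (f-steps l) (g-steps l)
  where
  open ≡-Reasoning
  previous : g l ≡ D + f l
  previous = lockstep n 1<n f-steps g-steps n∣D agree g₀ l (<⇒≤ l<L)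
  step : f (suc l) ≡ f l ⊎ f (suc l) ≡ suc (f l) → g (suc l) ≡ g l ⊎ g (suc l) ≡ suc (g l) →
         g (suc l) ≡ D + f (suc l)
  step (inj₁ f-stays) (inj₁ g-stays) = trans g-stays (trans previous (cong (D +_) (sym f-stays)))
  step (inj₂ f-moves) (inj₂ g-moves) =
    trans g-moves (trans (cong suc previous) (trans (sym (+-suc D (f l))) (cong (D +_) (sym f-moves))))
  step (inj₁ f-stays) (inj₂ g-moves) = ⊥-elim (%-+-≢ n 0 (f l) 1<n (sym (begin
    f l % n               ≡⟨ cong (_% n) f-stays ⟨
    f (suc l) % n         ≡⟨ agree (suc l) l<L ⟩
    g (suc l) % n         ≡⟨ cong (_% n) (trans g-moves (trans (cong suc previous) (sym (+-suc D (f l))))) ⟩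
    (D + suc (f l)) % n   ≡⟨ %-remove-+ˡ (suc (f l)) n∣D ⟩
    suc (f l) % n         ∎)))
  step (inj₂ f-moves) (inj₁ g-stays) = ⊥-elim (%-+-≢ n 0 (f l) 1<n (begin
    suc (f l) % n         ≡⟨ cong (_% n) f-moves ⟨
    f (suc l) % n         ≡⟨ agree (suc l) l<L ⟩
    g (suc l) % n         ≡⟨ cong (_% n) (trans g-stays previous) ⟩
    (D + f l) % n         ≡⟨ %-remove-+ˡ (f l) n∣D ⟩
    f l % n               ∎))

module _ {A : Set} (f : ℕ → A) where

  OccursAt : ℕ → List A → Set
  OccursAt i []      = ⊤
  OccursAt i (a ∷ u) = f i ≡ a × OccursAt (suc i) u

  occursAt-++⁻ : ∀ {i} u {v} → OccursAt i (u ++ v) → OccursAt i u × OccursAt (length u + i) v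
  occursAt-++⁻     []      occ            = tt , occ
  occursAt-++⁻ {i} (a ∷ u) {v} (f≡a , occ) =
    let occ-u , occ-v = occursAt-++⁻ u occ
    in (f≡a , occ-u) , subst (λ j → OccursAt j v) (+-suc (length u) i) occ-v

  occursAt-applyUpTo : ∀ {g} i n → (∀ j → g j ≡ f (j + i)) → OccursAt i (applyUpTo g n)
  occursAt-applyUpTo i zero    _  = tt
  occursAt-applyUpTo i (suc n) g≗ =
    sym (g≗ 0) , occursAt-applyUpTo (suc i) n (λ j → trans (g≗ (suc j)) (cong f (sym (+-suc j i))))

  factor⇒occursAt : ∀ {u} n → Factor u (applyUpTo f n) → ∃[ i ] OccursAt i u
  factor⇒occursAt {u} n (p , s , p++u++s≡) =
    let prefix = subst (OccursAt 0) (sym p++u++s≡) (occursAt-applyUpTo 0 n (λ j → cong f (sym (+-identityʳ j))))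
    in length p + 0 , proj₁ (occursAt-++⁻ u (proj₂ (occursAt-++⁻ p prefix)))

  occursAt-agree : ∀ {i j} u → OccursAt i u → OccursAt j u → ∀ l → l < length u → f (l + i) ≡ f (l + j)
  occursAt-agree         (a ∷ u) (fi≡a , _) (fj≡a , _) zero    _         = trans fi≡a (sym fj≡a)
  occursAt-agree {i} {j} (a ∷ u) (_ , occ-i) (_ , occ-j) (suc l) (s≤s l<) = begin
    f (suc (l + i)) ≡⟨ cong f (+-suc l i) ⟨
    f (l + suc i)   ≡⟨ occursAt-agree u occ-i occ-j l l< ⟩
    f (l + suc j)   ≡⟨ cong f (+-suc l j) ⟩
    f (suc (l + j)) ∎
    where open ≡-Reasoning

mod-≡⇒%-≡ : ∀ {m o} n .{{_ : NonZero n}} → m mod n ≡ o mod n → m % n ≡ o % n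
mod-≡⇒%-≡ {m} {o} n eq =
  trans (sym (toℕ-fromℕ< (m%n<n m n))) (trans (cong toℕ eq) (toℕ-fromℕ< (m%n<n o n)))

len : ℕ → ℕ
len ρ = vtm (ρ / 5)

open Blocks len (λ ρ → δ-pos _ _)

word : ℕ → Fin 5
word y = block y mod 5

word-≡ : ∀ y z → word y ≡ word z → block y % 5 ≡ block z % 5
word-≡ y z = mod-≡⇒%-≡ {block y} {block z} 5

1<5 : 1 < 5
1<5 = s≤s (s≤s z≤n)

-- Colours advance cyclically by at most one step, and two steps cannot return to the start.
reversedPair⇒sameBlock : ∀ {y z} → word y ≡ word (suc z) → word (suc y) ≡ word z → block (suc y) ≡ block y
reversedPair⇒sameBlock {y} {z} eq₁ eq₂ with block-step y | block-step z
... | inj₁ y-stays | _            = y-stays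
... | inj₂ y-moves | inj₁ z-stays = ⊥-elim (%-+-≢ 5 0 (block y) 1<5 (begin
  suc (block y) % 5   ≡⟨ cong (_% 5) y-moves ⟨
  block (suc y) % 5   ≡⟨ word-≡ (suc y) z eq₂ ⟩
  block z % 5         ≡⟨ cong (_% 5) z-stays ⟨
  block (suc z) % 5   ≡⟨ word-≡ y (suc z) eq₁ ⟨
  block y % 5         ∎))
  where open ≡-Reasoning
... | inj₂ y-moves | inj₂ z-moves = ⊥-elim (%-+-≢ 5 1 (block y) (s≤s (s≤s (s≤s z≤n))) (begin
  suc (suc (block y)) % 5 ≡⟨ %-cong-suc 5 (suc (block y)) (block z)
                               (trans (cong (_% 5) (sym y-moves)) (word-≡ (suc y) z eq₂)) ⟩
  suc (block z) % 5       ≡⟨ cong (_% 5) z-moves ⟨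
  block (suc z) % 5       ≡⟨ word-≡ y (suc z) eq₁ ⟨
  block y % 5             ∎))
  where open ≡-Reasoning

reversible⇒sameBlock : ∀ {y z} a u v → OccursAt word y (a ∷ u) → OccursAt word z (u ʳ++ a ∷ v) →
                       block (length u + y) ≡ block y
reversible⇒sameBlock         a []      v _                     _     = refl
reversible⇒sameBlock {y} {z} a (b ∷ u) v (wy≡a , wy+1≡b , occ) occ-z = begin
  block (suc (length u + y)) ≡⟨ cong block (+-suc (length u) y) ⟨
  block (length u + suc y)   ≡⟨ reversible⇒sameBlock b u (a ∷ v) (wy+1≡b , occ) occ-z ⟩
  block (suc y)              ≡⟨ reversedPair⇒sameBlock {y} {length (reverse u) + z}
                                  (trans wy≡a (sym wz+1≡a)) (trans wy+1≡b (sym wz≡b)) ⟩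
  block y                    ∎
  where
  open ≡-Reasoning
  junction = proj₂ (occursAt-++⁻ word (reverse u) (subst (OccursAt word z) (ʳ++-defn u) occ-z))
  wz≡b   = proj₁ junction
  wz+1≡a = proj₁ (proj₂ junction)

reversible⇒block-≤ : ∀ {y z} a u v → OccursAt word y (a ∷ u) → OccursAt word z (u ʳ++ a ∷ v) →
                     block (length (a ∷ u) + y) ≤ suc (block y)
reversible⇒block-≤ {y} a u v occ-y occ-z =
  ≤-trans (block-suc-≤ (length u + y)) (s≤s (≤-reflexive (reversible⇒sameBlock a u v occ-y occ-z)))

shift⇒vtm-square : ∀ {r s L} k → (∀ l → l ≤ L → block (l + s) ≡ suc k * 5 + block (l + r)) →
                   suc k * 5 + block r ≤ 3 + block (L + r) → Square vtm (suc (block r) / 5) (suc k)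
shift⇒vtm-square {r} {s} {L} k shifted bound j j<1+k = begin
  vtm (j + b)           ≡⟨ cong vtm ([m*n+o]/n≡m+o/n j (suc β) 5) ⟨
  len ρ                 ≡⟨ len-shift shifted (m≤n+m (suc β) (j * 5)) ρ<block ⟨
  len (suc k * 5 + ρ)   ≡⟨ cong vtm ([m*n+o]/n≡m+o/n (suc k) ρ 5) ⟩
  vtm (suc k + ρ / 5)   ≡⟨ cong (λ x → vtm (suc k + x)) ([m*n+o]/n≡m+o/n j (suc β) 5) ⟩
  vtm (suc k + (j + b)) ≡⟨ cong vtm (x∙yz≈y∙xz (suc k) j b) ⟩
  vtm (j + (suc k + b)) ∎
  where
  open ≡-Reasoning
  β = block r
  b = suc β / 5
  ρ = j * 5 + suc β
  ρ<block : suc ρ ≤ block (L + r)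
  ρ<block = ≤-trans (s≤s (≤-trans (≤-reflexive (+-suc (j * 5) β)) (s≤s (+-monoˡ-≤ β (*-monoˡ-≤ 5 (≤-pred j<1+k))))))
                    (≤-pred (≤-pred (≤-pred bound)))

-- Equal colours force a block shift D with 5 ∣ D; D = 0 contradicts the distance 3 between
-- the copies, and D = 5(k+1) yields a square in vtm.
repeat⇒⊥ : ∀ {r s L} → (∀ l → l ≤ L → word (l + r) ≡ word (l + s)) → 3 + r ≤ s →
           block s ≤ 3 + block (L + r) → ⊥
repeat⇒⊥ {r} {s} {L} agree 3+r≤s bound = conclude (%-≡⇒∣ 5 D (block r) D-colour)
  where
  D = block s ∸ block r
  s-shift : block s ≡ D + block r
  s-shift = sym (m∸n+n≡m (block-mono-≤ (≤-trans (m≤n+m r 3) 3+r≤s)))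
  D-colour : (D + block r) % 5 ≡ block r % 5
  D-colour = trans (cong (_% 5) (sym s-shift)) (sym (word-≡ r s (agree 0 z≤n)))
  conclude : 5 ∣ D → ⊥
  conclude (divides zero D≡0) = <⇒≱ (block-<-jump (λ ρ → δ≤3 _ _) r)
    (≤-trans (block-mono-≤ 3+r≤s) (≤-reflexive (trans s-shift (cong (_+ block r) D≡0))))
  conclude 5∣D@(divides (suc k) D≡) = vtm-squareFree k (suc (block r) / 5) (shift⇒vtm-square k
    (λ l l≤L → trans (shifted l l≤L) (cong (_+ block (l + r)) D≡))
    (subst (_≤ 3 + block (L + r)) (trans s-shift (cong (_+ block r) D≡)) bound))
    where
    shifted : ∀ l → l ≤ L → block (l + s) ≡ D + block (l + r)
    shifted = lockstep 5 1<5 {λ l → block (l + r)} {λ l → block (l + s)}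
                (λ l → block-step (l + r)) (λ l → block-step (l + s)) 5∣D
                (λ l l≤L → word-≡ (l + r) (l + s) (agree l l≤L)) s-shift

word-avoids-φ₂ : ∀ X Y₁ Y₂ → X ≢ [] → Y₁ ≢ [] → Y₂ ≢ [] →
                 ∃[ r ] OccursAt word r (X ++ Y₁ ++ Y₂ ++ X ++ []) →
                 ∃[ z₁ ] OccursAt word z₁ (reverse Y₁ ++ []) →
                 ∃[ z₂ ] OccursAt word z₂ (reverse Y₂ ++ []) → ⊥
word-avoids-φ₂ [] _  _  X≢[] _    _    _ _ _ = X≢[] refl
word-avoids-φ₂ _  [] _  _    Y≢[] _    _ _ _ = Y≢[] refl
word-avoids-φ₂ _  _  [] _    _    Y≢[] _ _ _ = Y≢[] refl
word-avoids-φ₂ X@(a ∷ xs) Y₁@(b₁ ∷ ys₁) Y₂@(b₂ ∷ ys₂) _ _ _ (r , occ) (_ , occ₁ᴿ) (_ , occ₂ᴿ) =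
  repeat⇒⊥ (λ l l≤ → occursAt-agree word X (proj₁ at-X) (proj₁ at-X′) l (s≤s l≤)) 3+r≤s bound
  where
  at-X  = occursAt-++⁻ word X occ
  at-Y₁ = occursAt-++⁻ word Y₁ (proj₂ at-X)
  at-Y₂ = occursAt-++⁻ word Y₂ (proj₂ at-Y₁)
  at-X′ = occursAt-++⁻ word X (proj₂ at-Y₂)
  bound : block (length Y₂ + (length Y₁ + (length X + r))) ≤ 3 + block (length xs + r)
  bound = ≤-trans (reversible⇒block-≤ b₂ ys₂ [] (proj₁ at-Y₂) (proj₁ (occursAt-++⁻ word (reverse Y₂) occ₂ᴿ)))
            (s≤s (≤-trans (reversible⇒block-≤ b₁ ys₁ [] (proj₁ at-Y₁) (proj₁ (occursAt-++⁻ word (reverse Y₁) occ₁ᴿ)))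
                          (s≤s (block-suc-≤ (length xs + r)))))
  3+r≤s : 3 + r ≤ length Y₂ + (length Y₁ + (length X + r))
  3+r≤s = s≤s (≤-trans (s≤s (≤-trans (s≤s (m≤n+m r (length xs))) (m≤n+m _ (length ys₁)))) (m≤n+m _ (length ys₂)))

theorem2p4 : Avoidable 5 φ₂
theorem2p4 n = applyUpTo word n , ≤-reflexive (sym (length-applyUpTo word n)) , avoids
  where
  avoids : Avoids (applyUpTo word n) φ₂
  avoids (h , nonErasing , xy₁y₂x ∷ y₁ᴿ ∷ y₂ᴿ ∷ []) =
    word-avoids-φ₂ (h x) (h y₁) (h y₂) (nonErasing x) (nonErasing y₁) (nonErasing y₂)
      (factor⇒occursAt word n xy₁y₂x) (factor⇒occursAt word n y₁ᴿ) (factor⇒occursAt word n y₂ᴿ)
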